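{- For all integers $n\ge 8$ and $d\ge 6$, \[ \binom{d-1}{2} + d\binom{n-d}{2} \le \binom{d-1}{2}\,\mathcal{F}_{P_n}. \]
   Context: $\mathcal{F}_{P_n}$ is the number of minimal forts of the path $P_n$ on $n$ vertices (a fort is a nonempty vertex set $F$ such that every vertex outside $F$ has zero or at least two neighbors in $F$; minimal means no proper subset is a fort); it is known to satisfy $a_m=a_{m-2}+a_{m-3}$ with $a_1=a_2=a_3=1$. Binomial coefficients use the convention $\binom{m}{2}=0$ for integers $m<2$. -}

module Defs where

open import Data.Nat using (ℕ; zero; suc)
open import Data.Bool using (Bool; true; false)
open import Data.Fin using (Fin; toℕ)
open import Data.Fin.Subset using (Subset; _∈_; _∉_; _⊂_; _∩_; ∣_∣; Nonempty; inside; outside)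
open import Data.Fin.Subset.Properties using (nonempty?; _∈?_; _⊂?_)
import Data.Fin.Properties as FinP
open import Data.List using (List; []; _∷_; map; _++_; length; filter)
open import Data.Vec using (Vec; []; _∷_; tabulate)
open import Data.Product using (_×_; _,_)
open import Data.Sum using (_⊎_)
open import Relation.Nullary using (¬_; Dec; yes; no; does)
open import Relation.Nullary.Decidable using (_×-dec_; _⊎-dec_; ¬?; _→-dec_)
open import Relation.Binary.PropositionalEquality using (_≡_; _≢_)
import Data.Nat.Properties as NatP

PathAdj : ∀ {n} → Fin n → Fin n → Set
PathAdj i j = (toℕ j ≡ suc (toℕ i)) ⊎ (toℕ i ≡ suc (toℕ j))

pathAdj? : ∀ {n} (i j : Fin n) → Dec (PathAdj i j)
pathAdj? i j = (toℕ j NatP.≟ suc (toℕ i)) ⊎-dec (toℕ i NatP.≟ suc (toℕ j))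

neighbours : ∀ {n} → Fin n → Subset n
neighbours v = tabulate (λ u → does (pathAdj? v u))

IsFort : ∀ {n} → Subset n → Set
IsFort {n} F = Nonempty F × (∀ (v : Fin n) → v ∉ F → ∣ F ∩ neighbours v ∣ ≢ 1)

IsMinimalFort : ∀ {n} → Subset n → Set
IsMinimalFort {n} F = IsFort F × (∀ (G : Subset n) → G ⊂ F → ¬ IsFort G)

allSubsets : ∀ n → List (Subset n)
allSubsets zero = [] ∷ []
allSubsets (suc n) = map (outside ∷_) (allSubsets n) ++ map (inside ∷_) (allSubsets n)

isFort? : ∀ {n} (F : Subset n) → Dec (IsFort F)
isFort? F = nonempty? F ×-dec FinP.all? (λ v → ¬? (v ∈? F) →-dec ¬? (∣ F ∩ neighbours v ∣ NatP.≟ 1))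

isMinimalFort? : ∀ {n} (F : Subset n) → Dec (IsMinimalFort F)
isMinimalFort? {n} F = isFort? F ×-dec noFortBelow
  where
  open import Data.Fin.Subset.Properties using (anySubset?)
  noFortBelow : Dec (∀ (G : Subset n) → G ⊂ F → ¬ IsFort G)
  noFortBelow with anySubset? (λ G → G ⊂? F ×-dec isFort? G)
  ... | yes (G , G⊂F , fG) = no (λ h → h G G⊂F fG)
  ... | no ¬ex = yes (λ G G⊂F fG → ¬ex (G , G⊂F , fG))

numMinimalFortsPath : ℕ → ℕ
numMinimalFortsPath n = length (filter isMinimalFort? (allSubsets n))

{-# OPTIONS --safe #-}
-- Every fort of a path contains its first vertex. Hence a fort G inside 1 0 F must begin
-- 1 0 1 (vertex 1 is outside G and already sees vertex 0), and its tail is a fort inside F,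
-- proper when G is; similarly a fort inside 1 1 0 F begins 1 1, and dropping vertex 0
-- leaves a fort inside 1 0 F. So prepending 1 0 to the minimal forts of P_{n+1} and 1 1 0
-- to those of P_n yields distinct minimal forts of P_{n+3}, and 𝓕(P_{k+1}) dominates the
-- Padovan number p_k. Since f m = 2·C(m,2) + 3 satisfies f (m+3) ≤ f (m+1) + f m for m ≥ 6,
-- the Padovan recurrence propagates f m ≤ 3·p_{m+5} from finitely many checked cases, giving
-- 2·C(n−d,2) + 3 ≤ 3·𝓕(P_n). With 3d ≤ 2·C(d−1,2) for d ≥ 6 this yields
-- 3·(C(d−1,2) + d·C(n−d,2)) ≤ C(d−1,2)·(2·C(n−d,2) + 3) ≤ 3·C(d−1,2)·𝓕(P_n).
module Submission where

open import Defs
open import Data.Nat using (ℕ; _+_; _*_; _∸_; _≤_)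
open import Data.Nat.Combinatorics using (_C_)

open import Data.Empty using (⊥-elim)
open import Data.Fin using (Fin; zero; suc)
open import Data.Fin.Subset using (Subset; _∈_; _∉_; _⊂_; _∩_; ∣_∣; Empty; inside; outside)
open import Data.Fin.Subset.Properties using (drop-there; drop-∷-⊂)
open import Data.List using (List; []; _∷_; _++_; map; filter; length)
open import Data.List.Properties using (length-++; filter-++; map-++; map-∘; map-id)
open import Data.Nat using (suc; _≤′_; ≤′-refl; ≤′-step; z≤n; s≤s; _≤?_)
open import Data.Nat.Combinatorics using (nC1≡n; nCk+nC[k+1]≡[n+1]C[k+1])
open import Data.Nat.Properties
open import Data.Nat.Tactic.RingSolver using (solve-∀)
open import Data.Product using (_,_)
open import Data.Vec using ([]; _∷_; tabulate; here; there)
open import Function using (id; _∘_)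
open import Relation.Nullary using (¬_; yes; no; contradiction)
open import Relation.Nullary.Decidable using (True; toWitness)
open import Relation.Unary using (Pred; Decidable)
open import Relation.Binary.PropositionalEquality using (_≡_; _≢_; refl; sym; trans; cong; cong₂)
open ≤-Reasoning

private
  variable
    n : ℕ

degreeIn : Subset n → Fin n → ℕ
degreeIn F v = ∣ F ∩ neighbours v ∣

FortCondition : Subset n → Set
FortCondition {n} F = ∀ (v : Fin n) → v ∉ F → degreeIn F v ≢ 1

∣p∩∅∣≡0 : (p : Subset n) → ∣ p ∩ tabulate (λ _ → outside) ∣ ≡ 0
∣p∩∅∣≡0 []            = refl
∣p∩∅∣≡0 (inside  ∷ p) = ∣p∩∅∣≡0 p
∣p∩∅∣≡0 (outside ∷ p) = ∣p∩∅∣≡0 p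

degreeIn-drop : ∀ g (X : Subset (suc n)) (v : Fin n) →
                degreeIn (g ∷ X) (suc (suc v)) ≡ degreeIn X (suc v)
degreeIn-drop inside  _ _ = refl
degreeIn-drop outside _ _ = refl

fortCondition-outside∷⁻ : {H : Subset n} → FortCondition (outside ∷ H) → FortCondition H
fortCondition-outside∷⁻ c v v∉H = c (suc v) (v∉H ∘ drop-there)

fortCondition-∷outside∷⁻ : ∀ {g} {H : Subset n} →
                           FortCondition (g ∷ outside ∷ H) → FortCondition H
fortCondition-∷outside∷⁻ {g = g} {H} c v v∉H deg≡1 =
  c (suc (suc v)) (v∉H ∘ drop-there ∘ drop-there)
    (trans (degreeIn-drop g (outside ∷ H) v) deg≡1)

fortCondition-∷inside∷⁻ : ∀ {g} {H : Subset n} →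
                          FortCondition (g ∷ inside ∷ H) → FortCondition (inside ∷ H)
fortCondition-∷inside∷⁻ c zero 0∉ = contradiction here 0∉
fortCondition-∷inside∷⁻ {g = g} {H} c (suc v) v∉ deg≡1 =
  c (suc (suc v)) (v∉ ∘ drop-there) (trans (degreeIn-drop g (inside ∷ H) v) deg≡1)

fortCondition-inside∷⁺ : {H : Subset n} →
                         FortCondition (inside ∷ H) → FortCondition (inside ∷ inside ∷ H)
fortCondition-inside∷⁺ c zero 0∉ = contradiction here 0∉
fortCondition-inside∷⁺ c (suc zero) 1∉ = contradiction (there here) 1∉
fortCondition-inside∷⁺ {H = H} c (suc (suc v)) v∉ deg≡1 =
  c (suc v) (v∉ ∘ there) (trans (sym (degreeIn-drop inside (inside ∷ H) v)) deg≡1)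

fortCondition-outside∷⇒empty : {H : Subset n} →
                               FortCondition (outside ∷ H) → Empty (outside ∷ H)
fortCondition-outside∷⇒empty {H = []} _ (suc () , _)
fortCondition-outside∷⇒empty {H = inside ∷ H} c _ = c zero (λ ()) (cong suc (∣p∩∅∣≡0 H))
fortCondition-outside∷⇒empty {H = outside ∷ H} c (suc (suc x) , there x∈) =
  fortCondition-outside∷⇒empty (fortCondition-outside∷⁻ c) (suc x , x∈)

¬fortCondition-inside∷outside∷outside∷ : {H : Subset n} →
                                         ¬ FortCondition (inside ∷ outside ∷ outside ∷ H)
¬fortCondition-inside∷outside∷outside∷ {H = H} c =
  c (suc zero) (λ { (there ()) }) (cong suc (∣p∩∅∣≡0 H))

fort∋zero : {F : Subset (suc n)} → IsFort F → zero ∈ F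
fort∋zero {F = inside  ∷ _} _              = here
fort∋zero {F = outside ∷ _} (nonempty , c) = ⊥-elim (fortCondition-outside∷⇒empty c nonempty)

minimalFort-inside∷outside∷⁺ : {F : Subset n} →
                               IsMinimalFort F → IsMinimalFort (inside ∷ outside ∷ F)
minimalFort-inside∷outside∷⁺ {F = []}          (((() , _) , _) , _)
minimalFort-inside∷outside∷⁺ {F = outside ∷ F} (fort , _) =
  contradiction (fort∋zero fort) λ ()
minimalFort-inside∷outside∷⁺ {F = inside ∷ F}  ((_ , c) , minimal) =
  ((zero , here) , condition) , minimality
  where
  condition : FortCondition (inside ∷ outside ∷ inside ∷ F)
  condition zero          0∉ = contradiction here 0∉
  condition (suc zero)    _  ()
  condition (suc (suc v)) v∉ = c v (v∉ ∘ there ∘ there)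

  minimality : ∀ G → G ⊂ inside ∷ outside ∷ inside ∷ F → ¬ IsFort G
  minimality (outside ∷ G) _ fort = contradiction (fort∋zero fort) λ ()
  minimality (inside ∷ inside ∷ G) (G⊆ , _) _ = contradiction (G⊆ (there here)) λ { (there ()) }
  minimality (inside ∷ outside ∷ outside ∷ G) _ (_ , c′) =
    ¬fortCondition-inside∷outside∷outside∷ c′
  minimality (inside ∷ outside ∷ inside ∷ G) G⊂ (_ , c′) =
    minimal (inside ∷ G) (drop-∷-⊂ (drop-∷-⊂ G⊂))
            ((zero , here) , fortCondition-∷outside∷⁻ c′)

minimalFort-inside∷⁺ : {F : Subset n} → IsMinimalFort (inside ∷ outside ∷ F) →
                       IsMinimalFort (inside ∷ inside ∷ outside ∷ F)
minimalFort-inside∷⁺ {F = F} ((_ , c) , minimal) =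
  ((zero , here) , fortCondition-inside∷⁺ c) , minimality
  where
  minimality : ∀ G → G ⊂ inside ∷ inside ∷ outside ∷ F → ¬ IsFort G
  minimality (outside ∷ G) _ fort = contradiction (fort∋zero fort) λ ()
  minimality (_ ∷ _ ∷ inside ∷ G) (G⊆ , _) _ =
    contradiction (G⊆ (there (there here))) λ { (there (there ())) }
  minimality (inside ∷ outside ∷ outside ∷ G) _ (_ , c′) =
    ¬fortCondition-inside∷outside∷outside∷ c′
  minimality (inside ∷ inside ∷ G) G⊂ (_ , c′) =
    minimal (inside ∷ G) (drop-∷-⊂ G⊂) ((zero , here) , fortCondition-∷inside∷⁻ c′)

module _ {a b p q} {A : Set a} {B : Set b} {P : Pred A p} {Q : Pred B q}
         (P? : Decidable P) (Q? : Decidable Q) {f : A → B} where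

  length-filter≤length-filter-map : (∀ {x} → P x → Q (f x)) →
                                    ∀ xs → length (filter P? xs) ≤ length (filter Q? (map f xs))
  length-filter≤length-filter-map P⇒Q∘f [] = z≤n
  length-filter≤length-filter-map P⇒Q∘f (x ∷ xs) with P? x | Q? (f x)
  ... | yes _  | yes _   = s≤s (length-filter≤length-filter-map P⇒Q∘f xs)
  ... | yes px | no ¬qfx = contradiction (P⇒Q∘f px) ¬qfx
  ... | no _   | yes _   = m≤n⇒m≤1+n (length-filter≤length-filter-map P⇒Q∘f xs)
  ... | no _   | no _    = length-filter≤length-filter-map P⇒Q∘f xs

countMinimalForts : List (Subset n) → ℕ
countMinimalForts = length ∘ filter isMinimalFort?

countMinimalForts-++ : (xs ys : List (Subset n)) →
                       countMinimalForts (xs ++ ys) ≡ countMinimalForts xs + countMinimalForts ys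
countMinimalForts-++ xs ys =
  trans (cong length (filter-++ isMinimalFort? xs ys)) (length-++ (filter isMinimalFort? xs))

numMinimalFortsAmong : ∀ {m} → (Subset n → Subset m) → ℕ
numMinimalFortsAmong {n} f = countMinimalForts (map f (allSubsets n))

numMinimalFortsAmong-id : numMinimalFortsAmong {n} id ≡ numMinimalFortsPath n
numMinimalFortsAmong-id {n} = cong countMinimalForts (map-id (allSubsets n))

numMinimalFortsAmong-split : ∀ {m} (f : Subset (suc n) → Subset m) →
  numMinimalFortsAmong f ≡
  numMinimalFortsAmong (f ∘ (outside ∷_)) + numMinimalFortsAmong (f ∘ (inside ∷_))
numMinimalFortsAmong-split {n} f = begin-equality
  countMinimalForts (map f (map (outside ∷_) A ++ map (inside ∷_) A))
    ≡⟨ cong countMinimalForts (map-++ f (map (outside ∷_) A) _) ⟩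
  countMinimalForts (map f (map (outside ∷_) A) ++ map f (map (inside ∷_) A))
    ≡⟨ countMinimalForts-++ (map f (map (outside ∷_) A)) _ ⟩
  countMinimalForts (map f (map (outside ∷_) A)) + countMinimalForts (map f (map (inside ∷_) A))
    ≡⟨ cong₂ _+_ (cong countMinimalForts (map-∘ A)) (cong countMinimalForts (map-∘ A)) ⟨
  numMinimalFortsAmong (f ∘ (outside ∷_)) + numMinimalFortsAmong (f ∘ (inside ∷_)) ∎
  where A = allSubsets n

numMinimalFortsPath≤numMinimalFortsAmong : ∀ {m} (f : Subset n → Subset m) →
  (∀ {F} → IsMinimalFort F → IsMinimalFort (f F)) →
  numMinimalFortsPath n ≤ numMinimalFortsAmong f
numMinimalFortsPath≤numMinimalFortsAmong f f⁺ =
  length-filter≤length-filter-map isMinimalFort? isMinimalFort? f⁺ (allSubsets _)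

numMinimalFortsPath-step : ∀ n →
  numMinimalFortsPath (1 + n) + numMinimalFortsPath n ≤ numMinimalFortsPath (3 + n)
numMinimalFortsPath-step n = begin
  numMinimalFortsPath (1 + n) + numMinimalFortsPath n
    ≤⟨ +-mono-≤
         (numMinimalFortsPath≤numMinimalFortsAmong pre₁₀ minimalFort-inside∷outside∷⁺)
         (numMinimalFortsPath≤numMinimalFortsAmong pre₁₁₀
           (minimalFort-inside∷⁺ ∘ minimalFort-inside∷outside∷⁺)) ⟩
  # pre₁₀ + # pre₁₁₀
    ≤⟨ +-monoʳ-≤ (# pre₁₀) (m≤m+n (# pre₁₁₀) (# pre₁₁₁)) ⟩
  # pre₁₀ + (# pre₁₁₀ + # pre₁₁₁)
    ≡⟨ cong (# pre₁₀ +_) (numMinimalFortsAmong-split pre₁₁) ⟨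
  # pre₁₀ + # pre₁₁
    ≡⟨ numMinimalFortsAmong-split pre₁ ⟨
  # pre₁
    ≤⟨ m≤n+m (# pre₁) (# pre₀) ⟩
  # pre₀ + # pre₁
    ≡⟨ numMinimalFortsAmong-split {2 + n} id ⟨
  # id
    ≡⟨ numMinimalFortsAmong-id {3 + n} ⟩
  numMinimalFortsPath (3 + n) ∎
  where
  # : ∀ {k} → (Subset k → Subset (3 + n)) → ℕ
  # = numMinimalFortsAmong
  pre₀ pre₁ : Subset (2 + n) → Subset (3 + n)
  pre₀ = outside ∷_
  pre₁ = inside ∷_
  pre₁₀ pre₁₁ : Subset (1 + n) → Subset (3 + n)
  pre₁₀ F = inside ∷ outside ∷ F
  pre₁₁ F = inside ∷ inside ∷ F
  pre₁₁₀ pre₁₁₁ : Subset n → Subset (3 + n)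
  pre₁₁₀ F = inside ∷ inside ∷ outside ∷ F
  pre₁₁₁ F = inside ∷ inside ∷ inside ∷ F

≤-by-evaluation : ∀ {m n} {m≤n : True (m ≤? n)} → m ≤ n
≤-by-evaluation {m≤n = m≤n} = toWitness m≤n

padovan : ℕ → ℕ
padovan 0 = 1
padovan 1 = 1
padovan 2 = 1
padovan (suc (suc (suc k))) = padovan (suc k) + padovan k

padovan≤numMinimalFortsPath : ∀ k → padovan k ≤ numMinimalFortsPath (suc k)
padovan≤numMinimalFortsPath 0 = ≤-by-evaluation
padovan≤numMinimalFortsPath 1 = ≤-by-evaluation
padovan≤numMinimalFortsPath 2 = ≤-by-evaluation
padovan≤numMinimalFortsPath (suc (suc (suc k))) =
  ≤-trans (+-mono-≤ (padovan≤numMinimalFortsPath (suc k)) (padovan≤numMinimalFortsPath k))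
          (numMinimalFortsPath-step (suc k))

padovan-suc : ∀ k → padovan k ≤ padovan (suc k)
padovan-suc 0 = ≤-by-evaluation
padovan-suc 1 = ≤-by-evaluation
padovan-suc 2 = ≤-by-evaluation
padovan-suc (suc (suc (suc k))) = +-mono-≤ (padovan-suc (suc k)) (padovan-suc k)

padovan-mono : ∀ {i j} → i ≤ j → padovan i ≤ padovan j
padovan-mono = mono′ ∘ ≤⇒≤′
  where
  mono′ : ∀ {i j} → i ≤′ j → padovan i ≤ padovan j
  mono′ ≤′-refl          = ≤-refl
  mono′ {j = suc j} (≤′-step i≤′j) = ≤-trans (mono′ i≤′j) (padovan-suc j)

[1+m]C2≡m+mC2 : ∀ m → suc m C 2 ≡ m + m C 2
[1+m]C2≡m+mC2 m = trans (sym (nCk+nC[k+1]≡[n+1]C[k+1] m 1)) (cong (_+ m C 2) (nC1≡n m))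

b+a*m≤2*mC2 : ∀ {a b m₀ m} → b + a * m₀ ≤ 2 * (m₀ C 2) → a ≤ 2 * m₀ →
              m₀ ≤′ m → b + a * m ≤ 2 * (m C 2)
b+a*m≤2*mC2 base a≤2m₀ ≤′-refl = base
b+a*m≤2*mC2 {a} {b} base a≤2m₀ (≤′-step {m} m₀≤′m) = begin
  b + a * suc m         ≡⟨ shift a b m ⟩
  (b + a * m) + a       ≤⟨ +-mono-≤ (b+a*m≤2*mC2 base a≤2m₀ m₀≤′m)
                                    (≤-trans a≤2m₀ (*-monoʳ-≤ 2 (≤′⇒≤ m₀≤′m))) ⟩
  2 * (m C 2) + 2 * m   ≡⟨ trans (*-distribˡ-+ 2 m (m C 2)) (+-comm (2 * m) _) ⟨
  2 * (m + m C 2)       ≡⟨ cong (2 *_) ([1+m]C2≡m+mC2 m) ⟨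
  2 * (suc m C 2)       ∎
  where
  shift : ∀ a b m → b + a * suc m ≡ (b + a * m) + a
  shift = solve-∀

3*[1+m]≤2*mC2 : ∀ {m} → 5 ≤ m → 3 * suc m ≤ 2 * (m C 2)
3*[1+m]≤2*mC2 {m} 5≤m = ≤-trans (≤-reflexive (*-suc 3 m))
  (b+a*m≤2*mC2 {3} {3} {5} ≤-by-evaluation ≤-by-evaluation (≤⇒≤′ 5≤m))

3+4*m≤2*mC2 : ∀ {m} → 6 ≤ m → 3 + 4 * m ≤ 2 * (m C 2)
3+4*m≤2*mC2 6≤m = b+a*m≤2*mC2 {4} {3} {6} ≤-by-evaluation ≤-by-evaluation (≤⇒≤′ 6≤m)

2*mC2+3-subrecurrence : ∀ {m} → 6 ≤ m →
  2 * ((3 + m) C 2) + 3 ≤ (2 * ((1 + m) C 2) + 3) + (2 * (m C 2) + 3)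
2*mC2+3-subrecurrence {m} 6≤m = begin
  2 * ((3 + m) C 2) + 3
    ≡⟨ cong (λ x → 2 * x + 3) pascal² ⟩
  2 * (2 + m + (1 + m + (1 + m) C 2)) + 3
    ≡⟨ regroup m ((1 + m) C 2) ⟩
  (2 * ((1 + m) C 2) + 3) + ((3 + 4 * m) + 3)
    ≤⟨ +-monoʳ-≤ (2 * ((1 + m) C 2) + 3) (+-monoˡ-≤ 3 (3+4*m≤2*mC2 6≤m)) ⟩
  (2 * ((1 + m) C 2) + 3) + (2 * (m C 2) + 3) ∎
  where
  pascal² : (3 + m) C 2 ≡ 2 + m + (1 + m + (1 + m) C 2)
  pascal² = trans ([1+m]C2≡m+mC2 (2 + m)) (cong (2 + m +_) ([1+m]C2≡m+mC2 (1 + m)))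
  regroup : ∀ m t → 2 * (2 + m + (1 + m + t)) + 3 ≡ (2 * t + 3) + ((3 + 4 * m) + 3)
  regroup = solve-∀

2*mC2+3≤3*padovan[5+m] : ∀ m → 2 * (m C 2) + 3 ≤ 3 * padovan (5 + m)
2*mC2+3≤3*padovan[5+m] 0 = ≤-by-evaluation
2*mC2+3≤3*padovan[5+m] 1 = ≤-by-evaluation
2*mC2+3≤3*padovan[5+m] 2 = ≤-by-evaluation
2*mC2+3≤3*padovan[5+m] 3 = ≤-by-evaluation
2*mC2+3≤3*padovan[5+m] 4 = ≤-by-evaluation
2*mC2+3≤3*padovan[5+m] 5 = ≤-by-evaluation
2*mC2+3≤3*padovan[5+m] 6 = ≤-by-evaluation
2*mC2+3≤3*padovan[5+m] 7 = ≤-by-evaluation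
2*mC2+3≤3*padovan[5+m] 8 = ≤-by-evaluation
2*mC2+3≤3*padovan[5+m] (suc (suc (suc m@(suc (suc (suc (suc (suc (suc k))))))))) = begin
  2 * ((3 + m) C 2) + 3
    ≤⟨ 2*mC2+3-subrecurrence (m≤m+n 6 k) ⟩
  (2 * ((1 + m) C 2) + 3) + (2 * (m C 2) + 3)
    ≤⟨ +-mono-≤ (2*mC2+3≤3*padovan[5+m] (suc m)) (2*mC2+3≤3*padovan[5+m] m) ⟩
  3 * padovan (6 + m) + 3 * padovan (5 + m)
    ≡⟨ *-distribˡ-+ 3 (padovan (6 + m)) (padovan (5 + m)) ⟨
  3 * padovan (8 + m) ∎

2*mC2+3≤3*numMinimalFortsPath : ∀ {m n} → 6 + m ≤ n →
                                2 * (m C 2) + 3 ≤ 3 * numMinimalFortsPath n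
2*mC2+3≤3*numMinimalFortsPath {m} {suc n} (s≤s 5+m≤n) = begin
  2 * (m C 2) + 3                    ≤⟨ 2*mC2+3≤3*padovan[5+m] m ⟩
  3 * padovan (5 + m)                ≤⟨ *-monoʳ-≤ 3 (padovan-mono 5+m≤n) ⟩
  3 * padovan n                      ≤⟨ *-monoʳ-≤ 3 (padovan≤numMinimalFortsPath n) ⟩
  3 * numMinimalFortsPath (suc n)    ∎

a+b*t≤a*p : ∀ a b t p → 3 * b ≤ 2 * a → 2 * t + 3 ≤ 3 * p → a + b * t ≤ a * p
a+b*t≤a*p a b t p 3b≤2a 2t+3≤3p = *-cancelˡ-≤ 3 (begin
  3 * (a + b * t)      ≡⟨ expand a b t ⟩
  3 * a + 3 * b * t    ≤⟨ +-monoʳ-≤ (3 * a) (*-monoˡ-≤ t 3b≤2a) ⟩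
  3 * a + 2 * a * t    ≡⟨ factor a t ⟩
  a * (2 * t + 3)      ≤⟨ *-monoʳ-≤ a 2t+3≤3p ⟩
  a * (3 * p)          ≡⟨ swap a p ⟩
  3 * (a * p)          ∎)
  where
  expand : ∀ a b t → 3 * (a + b * t) ≡ 3 * a + 3 * b * t
  expand = solve-∀
  factor : ∀ a t → 3 * a + 2 * a * t ≡ a * (2 * t + 3)
  factor = solve-∀
  swap : ∀ a p → a * (3 * p) ≡ 3 * (a * p)
  swap = solve-∀

lemma29 : ∀ (n d : ℕ) → 8 ≤ n → 6 ≤ d →
    (d ∸ 1) C 2 + d * ((n ∸ d) C 2) ≤ ((d ∸ 1) C 2) * numMinimalFortsPath n
lemma29 n d@(suc d-1) 8≤n 6≤d =
  a+b*t≤a*p (d-1 C 2) d ((n ∸ d) C 2) (numMinimalFortsPath n)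
            (3*[1+m]≤2*mC2 (≤-pred 6≤d)) (2*mC2+3≤3*numMinimalFortsPath 6+[n∸d]≤n)
  where
  6+[n∸d]≤n : 6 + (n ∸ d) ≤ n
  6+[n∸d]≤n = begin
    6 + (n ∸ d)   ≤⟨ +-monoʳ-≤ 6 (∸-monoʳ-≤ n 6≤d) ⟩
    6 + (n ∸ 6)   ≡⟨ m+[n∸m]≡n (m+n≤o⇒n≤o 2 8≤n) ⟩
    n             ∎
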